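{- Let $A$ be an admissible set of addition chains and let $\alpha\in\mathscr{D}^A$. Then $\alpha$ is an $A$-stable defect (i.e., $\alpha=\delta^A(m)$ for some $A$-stable $m$) if and only if $\alpha$ is the smallest element $\beta\in\mathscr{D}^A$ satisfying $\beta\equiv\alpha\pmod 1$.
   Context: An addition chain for a positive integer $n$ is a sequence $(a_0,\ldots,a_r)$ with $a_0=1$, $a_r=n$, and for every $1\le k\le r$ there exist $0\le i,j<k$ with $a_k=a_i+a_j$; $r$ is its length. For a set $A$ of addition chains, $\ell^A(n)$ is the least length of an addition chain for $n$ belonging to $A$. $\nu_2(n)$ is the number of $1$'s in the binary expansion of $n$. $A$ is admissible if (i) for every $n\ge1$, $\ell^A(n)$ is defined and $\ell^A(n)\le\lfloor\log_2 n\rfloor+\nu_2(n)-1$, and (ii) for every $n\ge1$, $\ell^A(2n)\le\ell^A(n)+1$. The $A$-defect is $\delta^A(n)=\ell^A(n)-\log_2 n$, and $\mathscr{D}^A=\{\delta^A(n):n\ge1\}$. A positive integer $m$ is $A$-stable if $\ell^A(2^k m)=\ell^A(m)+k$ for all $k\ge0$. $\beta\equiv\alpha\pmod1$ means $\beta-\alpha\in\mathbb{Z}$. -}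

module Defs where

open import Data.Nat using (ℕ; zero; suc; _+_; _*_; _∸_; _^_; _≤_; _<_)
open import Data.Nat.DivMod using (_/_; _%_)
open import Data.Nat.Logarithm using (⌊log₂_⌋)
open import Data.Fin using (Fin; toℕ; fromℕ)
open import Data.Product using (Σ; ∃; _×_; _,_)
open import Relation.Binary.PropositionalEquality using (_≡_)

-- ν₂(n): number of 1's in the binary expansion of n (fuel n suffices).
popcountAux : ℕ → ℕ → ℕ
popcountAux zero    n = 0
popcountAux (suc f) n = n % 2 + popcountAux f (n / 2)

ν₂ : ℕ → ℕ
ν₂ n = popcountAux n n

record AdditionChain : Set where
  field
    len   : ℕ
    seq   : Fin (suc len) → ℕ
    start : seq Fin.zero ≡ 1
    step  : (k : Fin (suc len)) → 1 ≤ toℕ k →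
            Σ (Fin (suc len)) λ i → Σ (Fin (suc len)) λ j →
              toℕ i < toℕ k × toℕ j < toℕ k × seq k ≡ seq i + seq j

  target : ℕ
  target = seq (fromℕ len)

open AdditionChain public

ChainSet : Set₁
ChainSet = AdditionChain → Set

-- ℓ^A(n) = r : there is a chain for n in A of length r, and every chain
-- for n in A has length ≥ r.
MinLen : ChainSet → ℕ → ℕ → Set
MinLen A n r =
  (Σ AdditionChain λ c → A c × target c ≡ n × len c ≡ r) ×
  ((c : AdditionChain) → A c → target c ≡ n → r ≤ len c)

Admissible : ChainSet → Set
Admissible A =
  ((n : ℕ) → 1 ≤ n → Σ ℕ λ r → MinLen A n r × r ≤ ⌊log₂ n ⌋ + ν₂ n ∸ 1) ×
  ((n r s : ℕ) → 1 ≤ n → MinLen A n r → MinLen A (2 * n) s → s ≤ r + 1)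

-- δ^A(n) ≤ δ^A(m), i.e. ℓ(n) - log₂ n ≤ ℓ(m) - log₂ m,
-- equivalently 2^ℓ(n) · m ≤ 2^ℓ(m) · n.
DefectLE : ChainSet → ℕ → ℕ → Set
DefectLE A n m = (r s : ℕ) → MinLen A n r → MinLen A m s → 2 ^ r * m ≤ 2 ^ s * n

-- δ^A(n) = δ^A(m), equivalently 2^ℓ(n) · m = 2^ℓ(m) · n.
DefectEq : ChainSet → ℕ → ℕ → Set
DefectEq A n m = (r s : ℕ) → MinLen A n r → MinLen A m s → 2 ^ r * m ≡ 2 ^ s * n

-- δ^A(n) ≡ δ^A(m) (mod 1) iff log₂ n - log₂ m ∈ ℤ iff 2^a n = 2^b m for some a, b.
DefectCong : ℕ → ℕ → Set
DefectCong n m = Σ ℕ λ a → Σ ℕ λ b → 2 ^ a * n ≡ 2 ^ b * m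

Stable : ChainSet → ℕ → Set
Stable A m = (k r : ℕ) → MinLen A m r → MinLen A (2 ^ k * m) (r + k)

{-# OPTIONS --safe #-}
module Submission where

open import Defs
open import Data.Nat using (ℕ; _≤_; suc; _+_; _*_; _^_; s≤s; z≤n)
open import Data.Nat.Properties
open import Algebra.Properties.CommutativeSemigroup *-commutativeSemigroup using (x∙yz≈y∙xz)
open import Data.Product using (Σ; _×_; _,_)
open import Function.Bundles using (_⇔_; mk⇔; Equivalence)
open import Relation.Binary.PropositionalEquality

-- By admissibility (ii) the defect can only decrease along a ray p, 2p, 4p, …, and m is
-- stable exactly when it stays constant along the ray of m. Two numbers whose defects are
-- congruent mod 1 have rays that meet, so a stable ray carries the least defect of its
-- class. Conversely, if δ(n) is least in its class it cannot drop along the ray of n,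
-- so n itself is stable.

2^*2^ : ∀ x y n → 2 ^ x * (2 ^ y * n) ≡ 2 ^ (x + y) * n
2^*2^ x y n = trans (sym (*-assoc (2 ^ x) (2 ^ y) n)) (cong (_* n) (sym (^-distribˡ-+-* 2 x y)))

2^*-cancelʳ-≤ : ∀ {x y n} → 1 ≤ n → 2 ^ x * n ≤ 2 ^ y * n → x ≤ y
2^*-cancelʳ-≤ {x} {y} {suc n} _ le =
  ≮⇒≥ λ y<x → <⇒≱ (^-monoʳ-< 2 (s≤s (s≤s z≤n)) y<x) (*-cancelʳ-≤ (2 ^ x) (2 ^ y) (suc n) le)

2^*-pos : ∀ k {n} → 1 ≤ n → 1 ≤ 2 ^ k * n
2^*-pos k n≥1 = *-mono-≤ (m^n>0 2 k) n≥1

2^*-≤⇔exponent-≤ : ∀ {a b p n} s t → 1 ≤ n → 2 ^ a * p ≡ 2 ^ b * n →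
                    2 ^ s * p ≤ 2 ^ t * n ⇔ s + b ≤ a + t
2^*-≤⇔exponent-≤ {a} {b} {p} {n} s t n≥1 e = mk⇔ to from
  where
  open ≡-Reasoning
  scaled : 2 ^ a * (2 ^ s * p) ≡ 2 ^ (s + b) * n
  scaled = begin
    2 ^ a * (2 ^ s * p)  ≡⟨ x∙yz≈y∙xz (2 ^ a) (2 ^ s) p ⟩
    2 ^ s * (2 ^ a * p)  ≡⟨ cong (2 ^ s *_) e ⟩
    2 ^ s * (2 ^ b * n)  ≡⟨ 2^*2^ s b n ⟩
    2 ^ (s + b) * n      ∎
  to : 2 ^ s * p ≤ 2 ^ t * n → s + b ≤ a + t
  to le = 2^*-cancelʳ-≤ n≥1 (subst₂ _≤_ scaled (2^*2^ a t n) (*-monoʳ-≤ (2 ^ a) le))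
  from : s + b ≤ a + t → 2 ^ s * p ≤ 2 ^ t * n
  from le = *-cancelˡ-≤ (2 ^ a) {{m^n≢0 2 a}}
    (subst₂ _≤_ (sym scaled) (sym (2^*2^ a t n)) (*-monoˡ-≤ n (^-monoʳ-≤ 2 le)))

module _ {A : ChainSet} where

  MinLen-functional : ∀ {n r r′} → MinLen A n r → MinLen A n r′ → r ≡ r′
  MinLen-functional {r = r} {r′} ((c , c∈A , c↦n , ∣c∣≡r) , r-min)
                                 ((c′ , c′∈A , c′↦n , ∣c′∣≡r′) , r′-min) =
    ≤-antisym (subst (r ≤_) ∣c′∣≡r′ (r-min c′ c′∈A c′↦n)) (subst (r′ ≤_) ∣c∣≡r (r′-min c c∈A c↦n))

  DefectEq-refl : ∀ {n} → DefectEq A n n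
  DefectEq-refl r s mr ms = cong (λ e → 2 ^ e * _) (MinLen-functional mr ms)

  MinLen-2^*-≤ : Admissible A → ∀ {n} → 1 ≤ n → ∀ k {r t} →
                 MinLen A n r → MinLen A (2 ^ k * n) t → t ≤ k + r
  MinLen-2^*-≤ _ {n} _ 0 {t = t} mr mt =
    ≤-reflexive (MinLen-functional (subst (λ q → MinLen A q t) (*-identityˡ n) mt) mr)
  MinLen-2^*-≤ adm@(exists , doubling) {n} n≥1 (suc k) {r} {t} mr mt
    with exists (2 ^ k * n) (2^*-pos k n≥1)
  ... | u , mu , _ = begin
    t          ≤⟨ doubling (2 ^ k * n) u t (2^*-pos k n≥1) mu
                    (subst (λ q → MinLen A q t) (*-assoc 2 (2 ^ k) n) mt) ⟩
    u + 1      ≡⟨ +-comm u 1 ⟩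
    suc u      ≤⟨ s≤s (MinLen-2^*-≤ adm n≥1 k mr mu) ⟩
    suc k + r  ∎
    where open ≤-Reasoning

  Stable-intro : Admissible A → ∀ {m} → 1 ≤ m →
                 (∀ k {r t} → MinLen A m r → MinLen A (2 ^ k * m) t → r + k ≤ t) → Stable A m
  Stable-intro adm@(exists , _) {m} m≥1 lower k r mr with exists (2 ^ k * m) (2^*-pos k m≥1)
  ... | t , mt , _ = subst (MinLen A (2 ^ k * m)) t≡r+k mt
    where
    t≡r+k : t ≡ r + k
    t≡r+k = ≤-antisym (subst (t ≤_) (+-comm k r) (MinLen-2^*-≤ adm m≥1 k mr mt)) (lower k mr mt)

  Stable⇒MinLen-≤ : Admissible A → ∀ {m p r t} x y → Stable A m → MinLen A m r →
                    1 ≤ p → MinLen A p t → 2 ^ x * m ≡ 2 ^ y * p → r + x ≤ y + t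
  Stable⇒MinLen-≤ adm {r = r} x y st mr p≥1 mt e =
    MinLen-2^*-≤ adm p≥1 y mt (subst (λ q → MinLen A q (r + x)) e (st x r mr))

  Stable⇒DefectLE : Admissible A → ∀ {m n p} → 1 ≤ m → Stable A m → DefectEq A m n →
                    1 ≤ n → 1 ≤ p → DefectCong p n → DefectLE A n p
  Stable⇒DefectLE adm@(exists , _) {m} {n} {p} m≥1 st m≈n n≥1 p≥1 (a , b , e) s t ms mt
    with exists m m≥1
  ... | r , mr , _ = Equivalence.from (2^*-≤⇔exponent-≤ s t n≥1 e) exponents
    where
    open ≡-Reasoning
    rays-meet : 2 ^ (b + s) * m ≡ 2 ^ (r + a) * p
    rays-meet = begin
      2 ^ (b + s) * m      ≡⟨ 2^*2^ b s m ⟨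
      2 ^ b * (2 ^ s * m)  ≡⟨ cong (2 ^ b *_) (m≈n r s mr ms) ⟨
      2 ^ b * (2 ^ r * n)  ≡⟨ x∙yz≈y∙xz (2 ^ b) (2 ^ r) n ⟩
      2 ^ r * (2 ^ b * n)  ≡⟨ cong (2 ^ r *_) e ⟨
      2 ^ r * (2 ^ a * p)  ≡⟨ 2^*2^ r a p ⟩
      2 ^ (r + a) * p      ∎
    lengths : r + (b + s) ≤ r + (a + t)
    lengths = subst (r + (b + s) ≤_) (+-assoc r a t)
      (Stable⇒MinLen-≤ adm (b + s) (r + a) st mr p≥1 mt rays-meet)
    exponents : s + b ≤ a + t
    exponents = subst (_≤ a + t) (+-comm b s) (+-cancelˡ-≤ r _ _ lengths)

  DefectLE-ray⇒Stable : Admissible A → ∀ {n} → 1 ≤ n →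
                        (∀ k → DefectLE A n (2 ^ k * n)) → Stable A n
  DefectLE-ray⇒Stable adm {n} n≥1 no-drop = Stable-intro adm n≥1 λ k {r} {t} mr mt →
    Equivalence.to (2^*-≤⇔exponent-≤ r t n≥1 (*-identityˡ (2 ^ k * n))) (no-drop k r t mr mt)

proposition3p7 : (A : ChainSet) → Admissible A → (n : ℕ) → 1 ≤ n →
    ((Σ ℕ λ m → 1 ≤ m × Stable A m × DefectEq A m n) ⇔
     ((p : ℕ) → 1 ≤ p → DefectCong p n → DefectLE A n p))
proposition3p7 A adm n n≥1 = mk⇔ stable⇒least least⇒stable
  where
  stable⇒least : (Σ ℕ λ m → 1 ≤ m × Stable A m × DefectEq A m n) →
                 ((p : ℕ) → 1 ≤ p → DefectCong p n → DefectLE A n p)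
  stable⇒least (m , m≥1 , st , m≈n) p p≥1 = Stable⇒DefectLE adm m≥1 st m≈n n≥1 p≥1
  least⇒stable : ((p : ℕ) → 1 ≤ p → DefectCong p n → DefectLE A n p) →
                 (Σ ℕ λ m → 1 ≤ m × Stable A m × DefectEq A m n)
  least⇒stable least = n , n≥1 , DefectLE-ray⇒Stable adm n≥1 on-ray , DefectEq-refl
    where
    on-ray : ∀ k → DefectLE A n (2 ^ k * n)
    on-ray k = least (2 ^ k * n) (2^*-pos k n≥1) (0 , k , *-identityˡ (2 ^ k * n))
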